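{- For every $d\in\omega$ and every $\eta\in 2^{d+1}$ there is a quantifier-free formula $\psi(x;y_1,\dots,y_d)$ in the language $\{<\}$ such that $\mathcal{C}^o_\psi$ is finitely characterized by $\eta$ (with respect to the usual order on $\mathbb{Q}$).
   Context: For a quantifier-free $\{<\}$-formula $\varphi(x;y_1,\dots,y_n)$, $\mathcal{C}^o_\varphi=\{\varphi(\mathbb{Q};a_1,\dots,a_n):a_i\in\mathbb{Q},a_1<\dots<a_n\}\subseteq 2^{\mathbb{Q}}$, where $\varphi(\mathbb{Q};\bar a)=\{q\in\mathbb{Q}:(\mathbb{Q},<)\models\varphi(q;\bar a)\}$. A set $c$ induces $\eta\in 2^{d+1}$ on $B$ if there are $b_0<\dots<b_d$ in $B$ with $b_i\in c$ iff $\eta(i)=1$. For $\mathcal{C}\subseteq 2^{\mathbb{Q}}$ and $X_0\subseteq\mathbb{Q}$, $\mathcal{C}(X_0)=\{c\cap X_0:c\in\mathcal{C}\}$; $\mathcal{C}$ is finitely characterized by $\eta$ if for every finite $X_0\subseteq\mathbb{Q}$ and every $c\subseteq X_0$: $c\in\mathcal{C}(X_0)$ iff $c$ does not induce $\eta$ on $X_0$. -}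

module Defs where

open import Data.Nat using (ℕ; suc)
open import Data.Fin using (Fin; zero; suc) renaming (_<_ to _<ᶠ_)
open import Data.Bool using (Bool; true; false; _∧_; _∨_; not; T)
open import Data.Rational using (ℚ; _<_)
open import Data.Rational.Properties using (_≟_; _<?_)
open import Data.List using (List)
open import Data.List.Membership.DecPropositional _≟_ using (_∈_; _∈?_)
open import Data.Product using (Σ; _×_)
open import Relation.Nullary using (¬_)
open import Relation.Nullary.Decidable using (⌊_⌋)
open import Relation.Binary.PropositionalEquality using (_≡_)
open import Function.Bundles using (_⇔_)

-- Quantifier-free formulas in the language {<} (with equality) in n free
-- variables.  For a formula ψ(x; y₁,…,y_d) we take n = suc d, variable
-- zero is x and variable (suc i) is y_{i+1}.
data QF (n : ℕ) : Set where
  ⊤' ⊥'   : QF n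
  lt eq   : Fin n → Fin n → QF n
  neg     : QF n → QF n
  and or  : QF n → QF n → QF n

⟦_⟧ : ∀ {n} → QF n → (Fin n → ℚ) → Bool
⟦ ⊤' ⟧ ρ = true
⟦ ⊥' ⟧ ρ = false
⟦ lt v w ⟧ ρ = ⌊ ρ v <? ρ w ⌋
⟦ eq v w ⟧ ρ = ⌊ ρ v ≟ ρ w ⌋
⟦ neg φ ⟧ ρ = not (⟦ φ ⟧ ρ)
⟦ and φ χ ⟧ ρ = ⟦ φ ⟧ ρ ∧ ⟦ χ ⟧ ρ
⟦ or φ χ ⟧ ρ = ⟦ φ ⟧ ρ ∨ ⟦ χ ⟧ ρ

assign : ∀ {d} → ℚ → (Fin d → ℚ) → Fin (suc d) → ℚ
assign q a zero = q
assign q a (suc i) = a i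

instSet : ∀ {d} → QF (suc d) → (Fin d → ℚ) → ℚ → Bool
instSet φ a q = ⟦ φ ⟧ (assign q a)

StrictlyIncreasing : ∀ {m} → (Fin m → ℚ) → Set
StrictlyIncreasing {m} a = ∀ (i j : Fin m) → i <ᶠ j → a i < a j

-- membership of c in  𝒞^o_φ(X₀) = { c' ∩ X₀ : c' ∈ 𝒞^o_φ }
-- (finite X₀ given as a list, subsets of ℚ as characteristic functions)
InTrace : ∀ {d} → QF (suc d) → List ℚ → (ℚ → Bool) → Set
InTrace {d} φ X₀ c =
  Σ (Fin d → ℚ) λ a → StrictlyIncreasing a ×
    (∀ q → c q ≡ (⌊ q ∈? X₀ ⌋ ∧ instSet φ a q))

Induces : ∀ {d} → (ℚ → Bool) → (Fin (suc d) → Bool) → List ℚ → Set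
Induces {d} c η B =
  Σ (Fin (suc d) → ℚ) λ b → StrictlyIncreasing b ×
    ((∀ i → b i ∈ B) × (∀ i → c (b i) ≡ η i))

FinitelyCharacterized : ∀ {d} → QF (suc d) → (Fin (suc d) → Bool) → Set
FinitelyCharacterized φ η =
  ∀ (X₀ : List ℚ) (c : ℚ → Bool) → (∀ q → T (c q) → q ∈ X₀) →
    (InTrace φ X₀ c ⇔ (¬ Induces c η X₀))

module Submission where

-- For η ∈ 2^{d+1} and a₀ < … < a_{d-1} let the staircase S_η(ā) ⊆ ℚ be the
-- set that is ¬η₀ below a₀, η₀ at a₀, ¬η₁ strictly between a₀ and a₁,
-- η₁ at a₁, …, and ¬η_d above a_{d-1}.
--
--  * a staircase never induces η: if b₀ < … < b_d realised η on S_η(ā),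
--    then b₀ ≥ a₀ (below a₀ the staircase takes the value ¬η₀), so
--    b₁, …, b_d lie above a₀ and realise the tail of η on the staircase
--    of the tails of η and ā; by induction this is impossible;
--  * conversely, if c does not induce η on a finite X, a staircase agreeing
--    with c on X is built greedily: a₀ is the least point of X where c
--    takes the value η₀ (or a point above X if there is none), and the
--    construction recurses on the part of X above a₀ with the tail of η.

open import Defs
open import Data.Nat using (ℕ; suc; zero; s≤s; z<s)
open import Data.Fin using (Fin; zero; suc)
open import Data.Bool using (Bool; true; false; _∧_; _∨_; not; T)
open import Data.Bool.Properties using (∨-identityʳ; ¬-not; not-¬)
  renaming (_≟_ to _≟ᵇ_)
open import Data.Rational using (ℚ; _<_; _≤_; 0ℚ; 1ℚ; _+_; -_; _⊔_; _⊓_)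
open import Data.Rational.Properties
  using (_≟_; _<?_; <-cmp; <-trans; <-irrefl; <-asym; <⇒≢; ≤-total; ≤-refl;
         ≤-trans; <-≤-trans; ≤-<-trans; ≮⇒≥; +-monoʳ-<; +-identityʳ;
         p≤p⊔q; p≤q⊔p; p⊓q≤p; p⊓q≤q)
open import Data.List using (List; []; _∷_; filter)
open import Data.List.Relation.Unary.Any using (here; there)
open import Data.List.Membership.DecPropositional _≟_ using (_∈_; _∈?_)
open import Data.List.Membership.Propositional.Properties using (∈-filter⁺; ∈-filter⁻)
open import Data.Vec.Functional using (tail) renaming (_∷_ to _◂_)
open import Data.Product using (Σ; _×_; _,_; proj₁; proj₂)
open import Data.Sum using (_⊎_; inj₁; inj₂)
open import Data.Empty using (⊥-elim)
open import Data.Unit using (tt)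
open import Relation.Nullary using (¬_; Dec; yes; no)
open import Relation.Nullary.Decidable using (⌊_⌋; toWitness)
open import Relation.Binary.PropositionalEquality using (_≡_; refl; sym; trans; cong; subst)
open import Relation.Binary.Definitions using (tri<; tri≈; tri>)
open import Function.Bundles using (mk⇔)

⌊⌋-true : ∀ {A : Set} (a? : Dec A) → A → ⌊ a? ⌋ ≡ true
⌊⌋-true (yes _) _ = refl
⌊⌋-true (no ¬a) a = ⊥-elim (¬a a)

⌊⌋-false : ∀ {A : Set} (a? : Dec A) → ¬ A → ⌊ a? ⌋ ≡ false
⌊⌋-false (yes a) ¬a = ⊥-elim (¬a a)
⌊⌋-false (no _) _ = refl

staircase : ∀ {d} → (Fin (suc d) → Bool) → (Fin d → ℚ) → ℚ → Bool
staircase {zero} η a q = not (η zero)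
staircase {suc d} η a q =
  (⌊ q <? a zero ⌋ ∧ not (η zero)) ∨
    ((⌊ q ≟ a zero ⌋ ∧ η zero) ∨
     (⌊ a zero <? q ⌋ ∧ staircase (tail η) (tail a) q))

staircase-below : ∀ {d} (η : Fin (suc (suc d)) → Bool) (a : Fin (suc d) → ℚ) q →
                  q < a zero → staircase η a q ≡ not (η zero)
staircase-below η a q q<a₀
  rewrite ⌊⌋-true (q <? a zero) q<a₀ | ⌊⌋-false (q ≟ a zero) (<⇒≢ q<a₀)
        | ⌊⌋-false (a zero <? q) (<-asym q<a₀) = ∨-identityʳ _

staircase-at : ∀ {d} (η : Fin (suc (suc d)) → Bool) (a : Fin (suc d) → ℚ) →
               staircase η a (a zero) ≡ η zero
staircase-at η a
  rewrite ⌊⌋-false (a zero <? a zero) (<-irrefl refl)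
        | ⌊⌋-true (a zero ≟ a zero) refl = ∨-identityʳ _

staircase-above : ∀ {d} (η : Fin (suc (suc d)) → Bool) (a : Fin (suc d) → ℚ) q →
                  a zero < q → staircase η a q ≡ staircase (tail η) (tail a) q
staircase-above η a q a₀<q
  rewrite ⌊⌋-false (q <? a zero) (<-asym a₀<q)
        | ⌊⌋-false (q ≟ a zero) (λ e → <⇒≢ a₀<q (sym e))
        | ⌊⌋-true (a zero <? q) a₀<q = refl

const : ∀ {n} → Bool → QF n
const true = ⊤'
const false = ⊥'

⟦const⟧ : ∀ {n} b (ρ : Fin n → ℚ) → ⟦ const b ⟧ ρ ≡ b
⟦const⟧ true ρ = refl
⟦const⟧ false ρ = refl

-- The staircase formula with the role of x played by the variable x and
-- that of y₁, …, y_d by the variables ys; this generality is what makes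
-- the recursion on d possible.
staircaseFormulaOn : ∀ {n d} → (Fin (suc d) → Bool) → Fin n → (Fin d → Fin n) → QF n
staircaseFormulaOn {d = zero} η x ys = const (not (η zero))
staircaseFormulaOn {d = suc d} η x ys =
  or (and (lt x (ys zero)) (const (not (η zero))))
     (or (and (eq x (ys zero)) (const (η zero)))
         (and (lt (ys zero) x) (staircaseFormulaOn (tail η) x (tail ys))))

⟦staircaseFormulaOn⟧ : ∀ {n d} (η : Fin (suc d) → Bool) x (ys : Fin d → Fin n) ρ →
  ⟦ staircaseFormulaOn η x ys ⟧ ρ ≡ staircase η (λ i → ρ (ys i)) (ρ x)
⟦staircaseFormulaOn⟧ {d = zero} η x ys ρ = ⟦const⟧ _ ρ
⟦staircaseFormulaOn⟧ {d = suc d} η x ys ρ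
  rewrite ⟦const⟧ (not (η zero)) ρ | ⟦const⟧ (η zero) ρ
        | ⟦staircaseFormulaOn⟧ (tail η) x (tail ys) ρ = refl

staircaseFormula : ∀ {d} → (Fin (suc d) → Bool) → QF (suc d)
staircaseFormula η = staircaseFormulaOn η zero suc

staircaseFormula-defines : ∀ {d} (η : Fin (suc d) → Bool) a q →
  instSet (staircaseFormula η) a q ≡ staircase η a q
staircaseFormula-defines η a q = ⟦staircaseFormulaOn⟧ η zero suc (assign q a)

tail-increasing : ∀ {d} (a : Fin (suc d) → ℚ) → StrictlyIncreasing a →
                  StrictlyIncreasing (tail a)
tail-increasing a a-inc i j i<j = a-inc (suc i) (suc j) (s≤s i<j)

◂-increasing : ∀ {d} h (t : Fin d → ℚ) → StrictlyIncreasing t → (∀ i → h < t i) →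
               StrictlyIncreasing (h ◂ t)
◂-increasing h t t-inc h<t zero (suc j) _ = h<t j
◂-increasing h t t-inc h<t (suc i) (suc j) (s≤s i<j) = t-inc i j i<j

◂-above : ∀ {d} {L h} (t : Fin d → ℚ) → L < h → (∀ i → h < t i) → ∀ i → L < (h ◂ t) i
◂-above t L<h h<t zero = L<h
◂-above t L<h h<t (suc i) = <-trans L<h (h<t i)

staircase-avoids : ∀ {d} (η : Fin (suc d) → Bool) (a : Fin d → ℚ) → StrictlyIncreasing a →
  (b : Fin (suc d) → ℚ) → StrictlyIncreasing b → ¬ (∀ i → staircase η a (b i) ≡ η i)
staircase-avoids {zero} η a _ b _ realises = not-¬ refl (sym (realises zero))
staircase-avoids {suc d} η a a-inc b b-inc realises with b zero <? a zero
... | yes b₀<a₀ = not-¬ refl (trans (sym (realises zero)) (staircase-below η a (b zero) b₀<a₀))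
... | no b₀≮a₀ =
  staircase-avoids (tail η) (tail a) (tail-increasing a a-inc) (tail b) (tail-increasing b b-inc)
    (λ i → trans (sym (staircase-above η a (b (suc i)) (a₀<tail-b i))) (realises (suc i)))
  where
  a₀<tail-b : ∀ i → a zero < b (suc i)
  a₀<tail-b i = ≤-<-trans (≮⇒≥ b₀≮a₀) (b-inc zero (suc i) z<s)

p<p+1 : ∀ p → p < p + 1ℚ
p<p+1 p = subst (_< p + 1ℚ) (+-identityʳ p) (+-monoʳ-< p (toWitness {a? = 0ℚ <? 1ℚ} tt))

p-1<p : ∀ p → p + - 1ℚ < p
p-1<p p = subst (p + - 1ℚ <_) (+-identityʳ p) (+-monoʳ-< p (toWitness {a? = - 1ℚ <? 0ℚ} tt))

strictUpperBound : (xs : List ℚ) → Σ ℚ λ U → ∀ x → x ∈ xs → x < U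
strictUpperBound [] = 0ℚ , λ _ ()
strictUpperBound (y ∷ ys) with strictUpperBound ys
... | U , ys<U = (y + 1ℚ) ⊔ U , λ
  { _ (here refl) → <-≤-trans (p<p+1 y) (p≤p⊔q (y + 1ℚ) U)
  ; x (there x∈ys) → <-≤-trans (ys<U x x∈ys) (p≤q⊔p (y + 1ℚ) U) }

strictLowerBound : (xs : List ℚ) → Σ ℚ λ L → ∀ x → x ∈ xs → L < x
strictLowerBound [] = 0ℚ , λ _ ()
strictLowerBound (y ∷ ys) with strictLowerBound ys
... | L , L<ys = (y + - 1ℚ) ⊓ L , λ
  { _ (here refl) → ≤-<-trans (p⊓q≤p (y + - 1ℚ) L) (p-1<p y)
  ; x (there x∈ys) → ≤-<-trans (p⊓q≤q (y + - 1ℚ) L) (L<ys x x∈ys) }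

increasingAbove : ∀ d (U : ℚ) → Σ (Fin d → ℚ) λ a → StrictlyIncreasing a × (∀ i → U < a i)
increasingAbove zero U = (λ ()) , (λ ()) , (λ ())
increasingAbove (suc d) U with increasingAbove d (U + 1ℚ)
... | a , a-inc , U+1<a =
  (U + 1ℚ) ◂ a , ◂-increasing _ a a-inc U+1<a , ◂-above a (p<p+1 U) U+1<a

leastSatisfying : (P : ℚ → Set) → (∀ x → Dec (P x)) → (xs : List ℚ) →
  (∀ x → x ∈ xs → ¬ P x) ⊎ Σ ℚ λ m → m ∈ xs × P m × (∀ x → x ∈ xs → P x → m ≤ x)
leastSatisfying P P? [] = inj₁ (λ x ())
leastSatisfying P P? (y ∷ ys) with leastSatisfying P P? ys | P? y
... | inj₁ none | no ¬Py = inj₁ λ { _ (here refl) → ¬Py ; x (there x∈) → none x x∈ }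
... | inj₁ none | yes Py = inj₂ (y , here refl , Py ,
      λ { _ (here refl) _ → ≤-refl ; x (there x∈) Px → ⊥-elim (none x x∈ Px) })
... | inj₂ (m , m∈ , Pm , least) | no ¬Py = inj₂ (m , there m∈ , Pm ,
      λ { _ (here refl) Py → ⊥-elim (¬Py Py) ; x (there x∈) Px → least x x∈ Px })
... | inj₂ (m , m∈ , Pm , least) | yes Py with ≤-total m y
...   | inj₁ m≤y = inj₂ (m , there m∈ , Pm ,
        λ { _ (here refl) _ → m≤y ; x (there x∈) Px → least x x∈ Px })
...   | inj₂ y≤m = inj₂ (y , here refl , Py ,
        λ { _ (here refl) _ → ≤-refl ; x (there x∈) Px → ≤-trans y≤m (least x x∈ Px) })

above-filter : ∀ m (X : List ℚ) q → q ∈ filter (m <?_) X → m < q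
above-filter m X q q∈X⁺ = proj₂ (∈-filter⁻ (m <?_) {xs = X} q∈X⁺)

-- If c takes the value η₀ at m ∈ X, any realisation of tail η above m
-- extends by m to a realisation of η; so if c does not induce η on X, it
-- does not induce tail η on the part of X above m.
noη-above : ∀ {d} m (X : List ℚ) (c : ℚ → Bool) {η : Fin (suc (suc d)) → Bool} →
  ¬ Induces c η X → m ∈ X → c m ≡ η zero → ¬ Induces c (tail η) (filter (m <?_) X)
noη-above m X c {η} noη m∈X cm≡η₀ (b , b-inc , b∈X⁺ , cb≡η⁺) =
  noη (m ◂ b , ◂-increasing m b b-inc (λ i → above-filter m X _ (b∈X⁺ i)) , b∈X , cb≡η)
  where
  b∈X : ∀ i → (m ◂ b) i ∈ X
  b∈X zero = m∈X
  b∈X (suc i) = proj₁ (∈-filter⁻ (m <?_) {xs = X} (b∈X⁺ i))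

  cb≡η : ∀ i → c ((m ◂ b) i) ≡ η i
  cb≡η zero = cm≡η₀
  cb≡η (suc i) = cb≡η⁺ i

Agrees : (ℚ → Bool) → (ℚ → Bool) → List ℚ → Set
Agrees c s X = ∀ q → q ∈ X → c q ≡ s q

fitStaircase : ∀ {d} (η : Fin (suc d) → Bool) (L : ℚ) (X : List ℚ) (c : ℚ → Bool) →
  (∀ q → q ∈ X → L < q) → ¬ Induces c η X →
  Σ (Fin d → ℚ) λ a → StrictlyIncreasing a × (∀ i → L < a i) × Agrees c (staircase η a) X
fitStaircase {zero} η L X c _ noη = (λ ()) , (λ ()) , (λ ()) , agrees
  where
  -- a point of X where c takes the value η₀ would realise η by itself
  agrees : Agrees c (λ _ → not (η zero)) X
  agrees q q∈X = ¬-not λ cq≡η₀ →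
    noη ((λ _ → q) , (λ { zero zero () }) , (λ _ → q∈X) , (λ { zero → cq≡η₀ }))
fitStaircase {suc d} η L X c X>L noη
  with leastSatisfying (λ x → c x ≡ η zero) (λ x → c x ≟ᵇ η zero) X
... | inj₁ never-η₀ with strictUpperBound (L ∷ X)
...   | U , below-U with increasingAbove (suc d) U
...     | a , a-inc , U<a = a , a-inc , (λ i → <-trans L<U (U<a i)) , agrees
  where
  L<U : L < U
  L<U = below-U L (here refl)

  -- all of X lies below a₀, where the staircase is constantly ¬η₀
  agrees : Agrees c (staircase η a) X
  agrees q q∈X = trans (¬-not (never-η₀ q q∈X))
    (sym (staircase-below η a q (<-trans (below-U q (there q∈X)) (U<a zero))))
fitStaircase {suc d} η L X c X>L noη
    | inj₂ (m , m∈X , cm≡η₀ , m-least)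
    with fitStaircase (tail η) m (filter (m <?_) X) c (above-filter m X) (noη-above m X c noη m∈X cm≡η₀)
...   | a⁺ , a⁺-inc , m<a⁺ , agrees⁺ =
  m ◂ a⁺ , ◂-increasing m a⁺ a⁺-inc m<a⁺ , ◂-above a⁺ (X>L m m∈X) m<a⁺ , agrees
  where
  agrees : Agrees c (staircase η (m ◂ a⁺)) X
  agrees q q∈X with <-cmp q m
  ... | tri< q<m _ _ =
    trans (¬-not λ cq≡η₀ → <-irrefl refl (<-≤-trans q<m (m-least q q∈X cq≡η₀)))
          (sym (staircase-below η (m ◂ a⁺) q q<m))
  ... | tri≈ _ refl _ = trans cm≡η₀ (sym (staircase-at η (m ◂ a⁺)))
  ... | tri> _ _ m<q =
    trans (agrees⁺ q (∈-filter⁺ (m <?_) q∈X m<q)) (sym (staircase-above η (m ◂ a⁺) q m<q))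

trace⇒agrees : (X : List ℚ) (c s : ℚ → Bool) →
  (∀ q → c q ≡ (⌊ q ∈? X ⌋ ∧ s q)) → Agrees c s X
trace⇒agrees X c s trace q q∈X = trans (trace q) (cong (_∧ s q) (⌊⌋-true (q ∈? X) q∈X))

agrees⇒trace : (X : List ℚ) (c s : ℚ → Bool) → (∀ q → T (c q) → q ∈ X) →
  Agrees c s X → ∀ q → c q ≡ (⌊ q ∈? X ⌋ ∧ s q)
agrees⇒trace X c s supported agrees q with q ∈? X
... | yes q∈X = agrees q q∈X
... | no q∉X = ¬-not λ cq≡true → q∉X (supported q (subst T (sym cq≡true) tt))

lemma4p1 : ∀ (d : ℕ) (η : Fin (suc d) → Bool) →
    Σ (QF (suc d)) λ ψ → FinitelyCharacterized ψ η
lemma4p1 d η = staircaseFormula η , λ X c supported → mk⇔ (avoids X c) (fits X c supported)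
  where
  ψ-trace : ∀ X a q → (⌊ q ∈? X ⌋ ∧ instSet (staircaseFormula η) a q) ≡ (⌊ q ∈? X ⌋ ∧ staircase η a q)
  ψ-trace X a q = cong (⌊ q ∈? X ⌋ ∧_) (staircaseFormula-defines η a q)

  avoids : ∀ X c → InTrace (staircaseFormula η) X c → ¬ Induces c η X
  avoids X c (a , a-inc , trace) (b , b-inc , b∈X , cb≡η) =
    staircase-avoids η a a-inc b b-inc λ i → trans (sym (agrees (b i) (b∈X i))) (cb≡η i)
    where
    agrees : Agrees c (staircase η a) X
    agrees = trace⇒agrees X c (staircase η a) (λ q → trans (trace q) (ψ-trace X a q))

  fits : ∀ X c → (∀ q → T (c q) → q ∈ X) → ¬ Induces c η X → InTrace (staircaseFormula η) X c
  fits X c supported noη with strictLowerBound X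
  ... | L , X>L with fitStaircase η L X c X>L noη
  ...   | a , a-inc , _ , agrees =
    a , a-inc , λ q → trans (agrees⇒trace X c (staircase η a) supported agrees q) (sym (ψ-trace X a q))
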